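{- Let $D=(V,A)$ be a connected directed multigraph, $c_l,c_u:A\to\mathbb{Z}$, $\Delta\in\mathbb{Z}^{\mathcal{C}}$, such that $\mathcal{B}_\Delta(D,c_l,c_u)$ is non-empty and no arc is rigid, and fix $v_0\in V$. Then the relation $\le$ on $\mathcal{B}_\Delta(D,c_l,c_u)$ is acyclic, i.e. it is a partial order.
   Context: $\mathcal{C}$ is the set of cycles of $D$ (cycles of the underlying undirected graph, each with a prescribed direction); $C^\pm$ are the arcs traversed forward/backward; $\delta(C,x)=\sum_{a\in C^+}x(a)-\sum_{a\in C^- }x(a)$. A $\Delta$-bond is $x:A\to\mathbb{Z}$ with $c_l\le x\le c_u$ arcwise and $\delta(C,x)=\Delta_C$ for all $C$; $\mathcal{B}_\Delta(D,c_l,c_u)$ is their set. An arc $a$ is rigid if $x(a)=y(a)$ for all $\Delta$-bonds $x,y$. For $U\subseteq V$, $\mathrm{push}(U,x)$ adds $1$ on arcs from $U$ to $V\setminus U$, subtracts $1$ on arcs from $V\setminus U$ to $U$ and is unchanged elsewhere. For $\Delta$-bonds, $x\le y$ means $y$ is reached from $x$ by a sequence of pushes at sets $U_i$ with $v_0\notin U_i$, all intermediate maps being $\Delta$-bonds. -}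

module Defs where

open import Data.Nat using (ℕ)
open import Data.Fin using (Fin; _≟_)
open import Data.Empty using (⊥)
open import Data.Bool using (Bool; true; false)
open import Data.Integer using (ℤ; _+_; _-_; -_; 0ℤ; 1ℤ; _≤_)
open import Data.List using (List; []; _∷_; map)
open import Data.List.Relation.Unary.Unique.Propositional using (Unique)
open import Data.Product using (Σ; _×_; _,_; proj₁; proj₂; ∃)
open import Relation.Binary.PropositionalEquality using (_≡_)
open import Relation.Binary.Construct.Closure.ReflexiveTransitive using (Star)
open import Relation.Nullary using (¬_; does)

record Digraph : Set where
  field
    n    : ℕ
    m    : ℕ
    tail : Fin m → Fin n
    head : Fin m → Fin n

module _ (D : Digraph) where
  open Digraph D

  Vertex : Set
  Vertex = Fin n

  Arc : Set
  Arc = Fin m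

  -- an arc together with a traversal direction (true = forward, false = backward)
  OArc : Set
  OArc = Arc × Bool

  start : OArc → Vertex
  start (a , true)  = tail a
  start (a , false) = head a

  end : OArc → Vertex
  end (a , true)  = head a
  end (a , false) = tail a

  IsWalk : Vertex → Vertex → List OArc → Set
  IsWalk u v []       = u ≡ v
  IsWalk u v (e ∷ es) = (start e ≡ u) × IsWalk (end e) v es

  Connected : Set
  Connected = (u v : Vertex) → ∃ λ w → IsWalk u v w

  -- a cycle of the underlying undirected graph with a prescribed direction:
  -- a nonempty closed walk with pairwise distinct vertices and distinct arcs
  IsCycle : List OArc → Set
  IsCycle []       = ⊥
  IsCycle (e ∷ es) =
    IsWalk (start e) (start e) (e ∷ es)
    × Unique (map start (e ∷ es))
    × Unique (map proj₁ (e ∷ es))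

  Cycle : Set
  Cycle = Σ (List OArc) IsCycle

  δ-list : List OArc → (Arc → ℤ) → ℤ
  δ-list []                 x = 0ℤ
  δ-list ((a , true)  ∷ es) x = x a + δ-list es x
  δ-list ((a , false) ∷ es) x = - x a + δ-list es x

  δ : Cycle → (Arc → ℤ) → ℤ
  δ C x = δ-list (proj₁ C) x

  module _ (cl cu : Arc → ℤ) (Δ : Cycle → ℤ) where

    IsBond : (Arc → ℤ) → Set
    IsBond x = ((a : Arc) → (cl a ≤ x a) × (x a ≤ cu a))
             × ((C : Cycle) → δ C x ≡ Δ C)

    Rigid : Arc → Set
    Rigid a = (x y : Arc → ℤ) → IsBond x → IsBond y → x a ≡ y a

    -- push(U, x); U ⊆ V given by its characteristic function
    push : (Vertex → Bool) → (Arc → ℤ) → (Arc → ℤ)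
    push U x a with U (tail a) | U (head a)
    ... | true  | false = x a + 1ℤ
    ... | false | true  = x a - 1ℤ
    ... | _     | _     = x a

    PushStep : Vertex → (Arc → ℤ) → (Arc → ℤ) → Set
    PushStep v₀ x y =
      IsBond x × IsBond y ×
      Σ (Vertex → Bool) λ U → (U v₀ ≡ false) × ((a : Arc) → y a ≡ push U x a)

    _≼[_]_ : (Arc → ℤ) → Vertex → (Arc → ℤ) → Set
    x ≼[ v₀ ] y = Star (PushStep v₀) x y

-- A push at U changes x by the coboundary of the indicator of U, so a chain of pushes
-- x ≤ y yields a potential φ : V → ℕ with φ(v₀) = 0 and y = x + ∂φ. If also y ≤ x with
-- potential χ, then ∂(φ + χ) = 0; on a connected graph φ + χ is therefore constant,
-- hence 0 since it vanishes at v₀. As potentials are non-negative, φ = 0 and y = x.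
module Submission where

open import Defs
open import Data.Bool using (Bool; true; false)
open import Data.Integer using (ℤ; +_; _+_; _-_; 0ℤ)
open import Data.Integer.Properties using (+-identityʳ; +-assoc; +-inverseʳ; pos-+; +-injective; i-j≡0⇒i≡j)
open import Data.Integer.Tactic.RingSolver using (solve-∀)
open import Data.List using ([]; _∷_)
open import Data.Nat using (ℕ) renaming (_+_ to _+ℕ_)
open import Data.Nat.Properties using (m+n≡0⇒m≡0)
open import Data.Product using (Σ; _,_)
open import Relation.Binary.Construct.Closure.ReflexiveTransitive using (ε; _◅_)
open import Relation.Binary.PropositionalEquality using (_≡_; refl; sym; trans; cong; cong₂; module ≡-Reasoning)
open import Relation.Nullary using (¬_)

open ≡-Reasoning

indicator : Bool → ℕ
indicator true  = 1
indicator false = 0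

+-inverse-shifts : ∀ (x y p q : ℤ) → y ≡ x + p → x ≡ y + q → p + q ≡ 0ℤ
+-inverse-shifts x y p q y≡x+p x≡y+q = begin
  p + q           ≡⟨ rearrange x p q ⟩
  (x + p) + q - x ≡⟨ cong (λ z → z + q - x) y≡x+p ⟨
  y + q - x       ≡⟨ cong (_- x) x≡y+q ⟨
  x - x           ≡⟨ +-inverseʳ x ⟩
  0ℤ              ∎
  where
  rearrange : ∀ x p q → p + q ≡ (x + p) + q - x
  rearrange = solve-∀

module _ (D : Digraph) where
  open Digraph D

  ∂ : (Vertex D → ℕ) → Arc D → ℤ
  ∂ φ a = + φ (tail a) - + φ (head a)

  ∂-+ : ∀ (φ χ : Vertex D → ℕ) a → ∂ (λ v → φ v +ℕ χ v) a ≡ ∂ φ a + ∂ χ a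
  ∂-+ φ χ a = begin
    + (φ t +ℕ χ t) - + (φ h +ℕ χ h)   ≡⟨ cong₂ _-_ (pos-+ (φ t) (χ t)) (pos-+ (φ h) (χ h)) ⟩
    (+ φ t + + χ t) - (+ φ h + + χ h) ≡⟨ regroup (+ φ t) (+ χ t) (+ φ h) (+ χ h) ⟩
    ∂ φ a + ∂ χ a                     ∎
    where
    t h : Vertex D
    t = tail a
    h = head a
    regroup : ∀ p q r s → (p + q) - (r + s) ≡ (p - r) + (q - s)
    regroup = solve-∀

  ∂≡0⇒tail≡head : ∀ (ψ : Vertex D → ℕ) a → ∂ ψ a ≡ 0ℤ → ψ (tail a) ≡ ψ (head a)
  ∂≡0⇒tail≡head ψ a ∂ψ≡0 = +-injective (i-j≡0⇒i≡j _ _ ∂ψ≡0)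

  walk-preserves : ∀ {A : Set} (ψ : Vertex D → A) → (∀ a → ψ (tail a) ≡ ψ (head a)) →
    ∀ {u v} w → IsWalk D u v w → ψ u ≡ ψ v
  walk-preserves ψ ψ-arc []                 u≡v           = cong ψ u≡v
  walk-preserves ψ ψ-arc ((a , true)  ∷ es) (refl , walk) = trans (ψ-arc a) (walk-preserves ψ ψ-arc es walk)
  walk-preserves ψ ψ-arc ((a , false) ∷ es) (refl , walk) = trans (sym (ψ-arc a)) (walk-preserves ψ ψ-arc es walk)

  connected⇒constant : Connected D → ∀ {A : Set} (ψ : Vertex D → A) →
    (∀ a → ψ (tail a) ≡ ψ (head a)) → ∀ u v → ψ u ≡ ψ v
  connected⇒constant conn ψ ψ-arc u v with conn u v
  ... | w , walk = walk-preserves ψ ψ-arc w walk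

  module _ (v₀ : Vertex D) where

    record Potential (x y : Arc D → ℤ) : Set where
      field
        φ      : Vertex D → ℕ
        φ-v₀   : φ v₀ ≡ 0
        y≡x+∂φ : ∀ a → y a ≡ x a + ∂ φ a

    Potential-antisym : Connected D → ∀ {x y} → Potential x y → Potential y x → ∀ a → x a ≡ y a
    Potential-antisym conn {x} {y} Pxy Pyx a = begin
      x a            ≡⟨ +-identityʳ (x a) ⟨
      x a + 0ℤ       ≡⟨ cong (_+_ (x a)) ∂φ≡0 ⟨
      x a + ∂ φ a    ≡⟨ y≡x+∂φ a ⟨
      y a            ∎
      where
      open Potential Pxy
      module χ = Potential Pyx
      ψ : Vertex D → ℕ
      ψ v = φ v +ℕ χ.φ v
      ψ-arc : ∀ b → ψ (tail b) ≡ ψ (head b)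
      ψ-arc b = ∂≡0⇒tail≡head ψ b (trans (∂-+ φ χ.φ b)
                  (+-inverse-shifts (x b) (y b) _ _ (y≡x+∂φ b) (χ.y≡x+∂φ b)))
      φ≡0 : ∀ v → φ v ≡ 0
      φ≡0 v = m+n≡0⇒m≡0 (φ v) (trans (connected⇒constant conn ψ ψ-arc v v₀)
                (cong₂ _+ℕ_ φ-v₀ χ.φ-v₀))
      ∂φ≡0 : ∂ φ a ≡ 0ℤ
      ∂φ≡0 = cong₂ (λ p q → + p - + q) (φ≡0 (tail a)) (φ≡0 (head a))

  module _ (cl cu : Arc D → ℤ) (Δ : Cycle D → ℤ) where

    push≡+∂ : ∀ U x a → push D cl cu Δ U x a ≡ x a + ∂ (λ v → indicator (U v)) a
    push≡+∂ U x a with U (tail a) | U (head a)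
    ... | true  | true  = sym (+-identityʳ (x a))
    ... | true  | false = refl
    ... | false | true  = refl
    ... | false | false = sym (+-identityʳ (x a))

    ≼⇒Potential : ∀ {v₀ x y} → _≼[_]_ D cl cu Δ x v₀ y → Potential v₀ x y
    ≼⇒Potential {x = x} ε = record { φ = λ _ → 0 ; φ-v₀ = refl ; y≡x+∂φ = λ a → sym (+-identityʳ (x a)) }
    ≼⇒Potential {x = x} {z} (_◅_ {j = y} (_ , _ , U , U-v₀ , y≡push) y≼z) = record
      { φ      = φ′
      ; φ-v₀   = cong₂ _+ℕ_ (cong indicator U-v₀) φ-v₀
      ; y≡x+∂φ = λ a → begin
          z a                      ≡⟨ y≡x+∂φ a ⟩
          y a + ∂ φ a              ≡⟨ cong (_+ ∂ φ a) (trans (y≡push a) (push≡+∂ U x a)) ⟩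
          (x a + ∂ 1ᵤ a) + ∂ φ a   ≡⟨ +-assoc (x a) (∂ 1ᵤ a) (∂ φ a) ⟩
          x a + (∂ 1ᵤ a + ∂ φ a)   ≡⟨ cong (_+_ (x a)) (∂-+ 1ᵤ φ a) ⟨
          x a + ∂ φ′ a             ∎
      }
      where
      open Potential (≼⇒Potential y≼z)
      1ᵤ : Vertex D → ℕ
      1ᵤ v = indicator (U v)
      φ′ : Vertex D → ℕ
      φ′ v = 1ᵤ v +ℕ φ v

corollary2 : (D : Digraph) → Connected D →
    (cl cu : Arc D → ℤ) → (Δ : Cycle D → ℤ) →
    Σ (Arc D → ℤ) (IsBond D cl cu Δ) →
    ((a : Arc D) → ¬ Rigid D cl cu Δ a) →
    (v₀ : Vertex D) →
    (x y : Arc D → ℤ) → IsBond D cl cu Δ x → IsBond D cl cu Δ y →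
    _≼[_]_ D cl cu Δ x v₀ y → _≼[_]_ D cl cu Δ y v₀ x →
    (a : Arc D) → x a ≡ y a
corollary2 D conn cl cu Δ _ _ v₀ x y _ _ x≼y y≼x =
  Potential-antisym D v₀ conn (≼⇒Potential D cl cu Δ x≼y) (≼⇒Potential D cl cu Δ y≼x)
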